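{- Let $s\ge1$ and $n,k\ge0$ be integers. Then $$\binom{n}{k}_{[s]}=\sum_{j_{1}}\sum_{j_{2}}\cdots\sum_{j_{s-1}}\binom{k}{j_{1}}\binom{j_{1}}{j_{2}}\cdots\binom{j_{s-2}}{j_{s-1}}\binom{n-\sum_{i=1}^{s-1}j_{i}}{k},$$ the sums running over all nonnegative integers $j_1,\dots,j_{s-1}$, and also $$\binom{n}{k}_{[s]}=\sum_{k_{1},\ldots,k_{s}\ge 0}\binom{k}{k_{1},k_{2},\ldots,k_{s}}\binom{n+k-\sum_{i=1}^{s}ik_{i}}{k},$$ where $\binom{k}{k_{1},\ldots,k_{s}}=\frac{k!}{k_1!\cdots k_s!}$ if $k_1+\cdots+k_s=k$ and $0$ otherwise.
   Context: For integers $n,k$ with $0\le k\le n$, $\binom{n}{k}_{[s]}$ is the number of lattice paths from $(0,0)$ to $(n,k)$ using steps from $\{(1,0),(1,1),(2,1),\ldots,(s,1)\}$; for $k<0$ or $k>n$ it is $0$. Binomial coefficients: $\binom{a}{b}=\frac{a!}{b!(a-b)!}$ if $a\ge b\ge0$ and $\binom{a}{b}=0$ otherwise (for all integers $a,b$). -}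

module Defs where

open import Data.Nat using (ℕ; zero; suc; _+_; _*_; _!; _/_; _≟_; NonZero)
open import Data.Nat.Properties using (_!≢0; m*n≢0)
open import Data.Nat.Combinatorics using (_C_)
open import Data.Integer using (ℤ; +_; -[1+_]) renaming (_-_ to _-ℤ_)
open import Data.Fin using (Fin; toℕ)
open import Data.Vec using (Vec; []; _∷_)
open import Data.List using (List; []; _∷_; length; filter; map; concatMap; upTo; allFin)
open import Data.Nat.ListAction using (sum)
open import Data.Product using (_×_; _,_)
open import Relation.Nullary using (does)
open import Relation.Binary.PropositionalEquality using (_≡_)
open import Data.Bool using (true; false)

-- Binomial coefficient with an integer top argument:
-- binom(a,b) = a!/(b!(a-b)!) if a ≥ b ≥ 0, and 0 otherwise.
-- (stdlib's  _C_  already returns 0 when b > a.)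

binomℤ : ℤ → ℕ → ℕ
binomℤ (+ a)    b = a C b
binomℤ -[1+ _ ] b = 0

-- Lattice paths with step set {(1,0),(1,1),(2,1),...,(s,1)}.
-- A step is an element of Fin (suc s): zero ↦ (1,0), suc i ↦ (toℕ i + 1, 1).

Step : ℕ → Set
Step s = Fin (suc s)

stepVec : ∀ {s} → Step s → ℕ × ℕ
stepVec Fin.zero    = 1 , 0
stepVec (Fin.suc i) = suc (toℕ i) , 1

endpoint : ∀ {s} → List (Step s) → ℕ × ℕ
endpoint []       = 0 , 0
endpoint (x ∷ xs) with stepVec x | endpoint xs
... | a , b | c , d = a + c , b + d

listsOfLength : ∀ {s} → ℕ → List (List (Step s))
listsOfLength zero    = [] ∷ []
listsOfLength {s} (suc m) =
  concatMap (λ x → map (x ∷_) (listsOfLength m)) (allFin (suc s))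

isEnd : ℕ → ℕ → ℕ × ℕ → Data.Bool.Bool
isEnd n k (a , b) with a ≟ n | b ≟ k
... | Relation.Nullary.yes _ | Relation.Nullary.yes _ = true
... | _ | _ = false

pathsOfLength : (s n k m : ℕ) → ℕ
pathsOfLength s n k m =
  length (filter (λ p → isEnd n k (endpoint p) Data.Bool.≟ true)
                 (listsOfLength {s} m))

-- Every step has x-increment ≥ 1, so a path to (n,k) has at most n steps;
-- hence this is the total number of lattice paths from (0,0) to (n,k).
pathCount : (s n k : ℕ) → ℕ
pathCount s n k = sum (map (pathsOfLength s n k) (upTo (suc n)))

sumTo : ℕ → (ℕ → ℕ) → ℕ
sumTo B f = sum (map f (upTo (suc B)))

sumVec : (m B : ℕ) → (Vec ℕ m → ℕ) → ℕ
sumVec zero    B f = f []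
sumVec (suc m) B f = sumTo B (λ j → sumVec m B (λ v → f (j ∷ v)))

vsum : ∀ {m} → Vec ℕ m → ℕ
vsum []       = 0
vsum (x ∷ xs) = x + vsum xs

chainProd : ∀ {m} → ℕ → Vec ℕ m → ℕ
chainProd k []       = 1
chainProd k (j ∷ js) = (k C j) * chainProd j js

weightedSumFrom : ∀ {m} → ℕ → Vec ℕ m → ℕ
weightedSumFrom i []       = 0
weightedSumFrom i (x ∷ xs) = i * x + weightedSumFrom (suc i) xs

weightedSum : ∀ {m} → Vec ℕ m → ℕ
weightedSum = weightedSumFrom 1

factProd : ∀ {m} → Vec ℕ m → ℕ
factProd []       = 1
factProd (x ∷ xs) = (x !) * factProd xs

factProd≢0 : ∀ {m} (v : Vec ℕ m) → NonZero (factProd v)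
factProd≢0 []       = _
factProd≢0 (x ∷ xs) = m*n≢0 (x !) (factProd xs) {{x !≢0}} {{factProd≢0 xs}}

multinomial : ∀ {m} → ℕ → Vec ℕ m → ℕ
multinomial k v with vsum v ≟ k
... | Relation.Nullary.yes _ = (k !) / factProd v
  where instance _ = factProd≢0 v
... | Relation.Nullary.no _  = 0

module Submission where

-- Write s = t + 1. A path to (n, k) has k rising steps (y₁ + 1, 1), …, (yₖ + 1, 1) with
-- 0 ≤ yᵢ ≤ t, and n − Σ yᵢ steps in all; the rising steps may occupy any k of these positions,
-- so there are Σ_{y ∈ {0,…,t}ᵏ} C(n − Σ y, k) paths. This closed form is proved by checking
-- that it obeys the first-step recurrence of the path count. Grouping the tuples y by
-- j_r = #{i : yᵢ ≥ r} gives the chain of binomials, and grouping them by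
-- k_r = #{i : yᵢ = r − 1} gives the multinomial form, where Σ r k_r = k + Σ yᵢ.

open import Defs
open import Data.Nat
open import Data.Nat.Properties
open import Data.Nat.Combinatorics using (_C_; nCk+nC[k+1]≡[n+1]C[k+1]; k>n⇒nCk≡0; nCk≡nC[n∸k]; nCk≡n!/k![n-k]!; k![n∸k]!∣n!)
open import Data.Nat.DivMod using (m/n*n≡m; m*n/n≡m; /-congˡ)
open import Data.Nat.ListAction using () renaming (sum to sumList)
open import Data.Nat.Tactic.RingSolver using (solve-∀)
open import Data.Integer using (ℤ; +_; -[1+_]; _-_)
import Data.Integer as ℤ
import Data.Integer.Properties as ℤ
import Data.Integer.Tactic.RingSolver as ℤSolver
open import Data.Fin as Fin using (Fin; toℕ)
open import Data.Fin.Properties using (opposite-prop)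
import Data.Fin.Permutation as Perm
open import Data.List using (List; []; _∷_; _++_; map; applyUpTo; upTo; length; filter; concatMap; tabulate)
open import Data.List.Properties using (map-cong)
open import Data.Vec using (Vec; []; _∷_)
open import Data.Bool as Bool using (Bool; true; false; if_then_else_)
open import Data.Product using (_×_; _,_; proj₁; proj₂)
open import Data.Product.Function.NonDependent.Propositional using (_×-⇔_)
open import Algebra.Properties.Semiring.Sum +-*-semiring
  using (sum; sum-cong-≗; sum-replicate-zero; ∑-distrib-+; ∑-comm; ∑-permute; *-distribˡ-sum)
open import Function using (_∘_; id)
open import Function.Bundles using (_⇔_; mk⇔)
open import Relation.Nullary using (Dec; yes; no; contradiction)
open import Relation.Nullary.Decidable using (does; _×-dec_; dec-true; dec-false; does-⇔)
open import Relation.Binary.PropositionalEquality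

∑< : ℕ → (ℕ → ℕ) → ℕ
∑< n f = sum {n} (f ∘ toℕ)

sum-applyUpTo : ∀ n (f g : ℕ → ℕ) → sumList (map f (applyUpTo g n)) ≡ ∑< n (f ∘ g)
sum-applyUpTo zero    f g = refl
sum-applyUpTo (suc n) f g = cong (_+_ (f (g 0))) (sum-applyUpTo n f (g ∘ suc))

sumTo≡∑< : ∀ B f → sumTo B f ≡ ∑< (suc B) f
sumTo≡∑< B f = sum-applyUpTo (suc B) f (λ i → i)

∑<-cong : ∀ n {f g : ℕ → ℕ} → (∀ i → f i ≡ g i) → ∑< n f ≡ ∑< n g
∑<-cong n f≗g = sum-cong-≗ {n} (f≗g ∘ toℕ)

∑<-cong-< : ∀ n {f g : ℕ → ℕ} → (∀ i → i < n → f i ≡ g i) → ∑< n f ≡ ∑< n g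
∑<-cong-< zero    _   = refl
∑<-cong-< (suc n) f≗g = cong₂ _+_ (f≗g 0 z<s) (∑<-cong-< n (λ i i<n → f≗g (suc i) (s<s i<n)))

∑<-zero : ∀ n {f : ℕ → ℕ} → (∀ i → f i ≡ 0) → ∑< n f ≡ 0
∑<-zero n f≗0 = trans (∑<-cong n f≗0) (sum-replicate-zero n)

∑<-distrib-+ : ∀ n (f g : ℕ → ℕ) → ∑< n (λ i → f i + g i) ≡ ∑< n f + ∑< n g
∑<-distrib-+ n f g = ∑-distrib-+ {n} (f ∘ toℕ) (g ∘ toℕ)

*-distribˡ-∑< : ∀ n c (f : ℕ → ℕ) → c * ∑< n f ≡ ∑< n (λ i → c * f i)
*-distribˡ-∑< n c f = *-distribˡ-sum {n} c (f ∘ toℕ)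

∑<-comm : ∀ m n (f : ℕ → ℕ → ℕ) → ∑< m (λ i → ∑< n (f i)) ≡ ∑< n (λ j → ∑< m (λ i → f i j))
∑<-comm m n f = ∑-comm {m} {n} (λ i j → f (toℕ i) (toℕ j))

∑<-+ : ∀ m n (f : ℕ → ℕ) → ∑< (m + n) f ≡ ∑< m f + ∑< n (λ i → f (m + i))
∑<-+ zero    n f = refl
∑<-+ (suc m) n f = trans (cong (_+_ (f 0)) (∑<-+ m n (f ∘ suc))) (sym (+-assoc (f 0) _ _))

∑<-truncate : ∀ {j B} (f : ℕ → ℕ) → j ≤ B → (∀ i → j < i → f i ≡ 0) → ∑< (suc B) f ≡ ∑< (suc j) f
∑<-truncate {j} {B} f j≤B f>j≡0 = begin
  ∑< (suc B) f
    ≡⟨ cong (λ m → ∑< m f) (m+[n∸m]≡n (s≤s j≤B)) ⟨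
  ∑< (suc j + (B ∸ j)) f
    ≡⟨ ∑<-+ (suc j) (B ∸ j) f ⟩
  ∑< (suc j) f + ∑< (B ∸ j) (λ i → f (suc j + i))
    ≡⟨ cong (_+_ (∑< (suc j) f)) (∑<-zero (B ∸ j) (λ i → f>j≡0 (suc j + i) (s≤s (m≤m+n j i)))) ⟩
  ∑< (suc j) f + 0
    ≡⟨ +-identityʳ _ ⟩
  ∑< (suc j) f
    ∎
  where open ≡-Reasoning

∑<-reverse : ∀ n (f : ℕ → ℕ) → ∑< n f ≡ ∑< n (λ i → f (n ∸ suc i))
∑<-reverse n f = trans (∑-permute {n} (f ∘ toℕ) Perm.reverse) (sum-cong-≗ {n} (λ i → cong f (opposite-prop i)))

∑<-pascal : ∀ N k (F : ℕ → ℕ) →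
  ∑< (suc N) (λ x → (suc k C x) * F x) ≡ ∑< (suc N) (λ x → (k C x) * F x) + ∑< N (λ x → (k C x) * F (suc x))
∑<-pascal N k F = begin
  1 * F 0 + ∑< N (λ x → (suc k C suc x) * F (suc x))
    ≡⟨ cong (_+_ (1 * F 0)) (∑<-cong N pascal) ⟩
  1 * F 0 + ∑< N (λ x → (k C x) * F (suc x) + (k C suc x) * F (suc x))
    ≡⟨ cong (_+_ (1 * F 0)) (∑<-distrib-+ N (λ x → (k C x) * F (suc x)) (λ x → (k C suc x) * F (suc x))) ⟩
  1 * F 0 + (∑< N (λ x → (k C x) * F (suc x)) + ∑< N (λ x → (k C suc x) * F (suc x)))
    ≡⟨ +-assoc-comm (1 * F 0) _ _ ⟩
  (1 * F 0 + ∑< N (λ x → (k C suc x) * F (suc x))) + ∑< N (λ x → (k C x) * F (suc x))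
    ∎
  where
  open ≡-Reasoning
  pascal : ∀ x → (suc k C suc x) * F (suc x) ≡ (k C x) * F (suc x) + (k C suc x) * F (suc x)
  pascal x = trans (cong (_* F (suc x)) (sym (nCk+nC[k+1]≡[n+1]C[k+1] k x))) (*-distribʳ-+ (F (suc x)) (k C x) _)
  +-assoc-comm : ∀ a b c → a + (b + c) ≡ (a + c) + b
  +-assoc-comm = solve-∀

∑<-binomial-truncate : ∀ {k B} (f : ℕ → ℕ) → k ≤ B → ∑< (suc B) (λ x → (k C x) * f x) ≡ ∑< (suc k) (λ x → (k C x) * f x)
∑<-binomial-truncate f k≤B = ∑<-truncate _ k≤B (λ x k<x → cong (_* f x) (k>n⇒nCk≡0 k<x))

C*-congʳ : ∀ k x {a b} → (x ≤ k → a ≡ b) → (k C x) * a ≡ (k C x) * b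
C*-congʳ k x {a} {b} a≡b with x ≤? k
... | yes x≤k = cong ((k C x) *_) (a≡b x≤k)
... | no  x≰k = trans (cong (_* a) kCx≡0) (cong (_* b) (sym kCx≡0))
  where
  kCx≡0 : k C x ≡ 0
  kCx≡0 = k>n⇒nCk≡0 (≰⇒> x≰k)

-- ∑tuples a m k h sums h (y₁ + ⋯ + yₖ) over all (y₁, …, yₖ) ∈ {a, …, a + m − 1}ᵏ.
∑tuples : (a m k : ℕ) → (ℕ → ℕ) → ℕ
∑tuples a m zero    h = h 0
∑tuples a m (suc k) h = ∑< m (λ y → ∑tuples a m k (λ σ → h (a + y + σ)))

∑tuples-cong : ∀ a m k {h h′ : ℕ → ℕ} → (∀ σ → h σ ≡ h′ σ) → ∑tuples a m k h ≡ ∑tuples a m k h′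
∑tuples-cong a m zero    h≗h′ = h≗h′ 0
∑tuples-cong a m (suc k) h≗h′ = ∑<-cong m (λ y → ∑tuples-cong a m k (λ σ → h≗h′ (a + y + σ)))

∑tuples-distrib-+ : ∀ a m k (h h′ : ℕ → ℕ) → ∑tuples a m k (λ σ → h σ + h′ σ) ≡ ∑tuples a m k h + ∑tuples a m k h′
∑tuples-distrib-+ a m zero    h h′ = refl
∑tuples-distrib-+ a m (suc k) h h′ =
  trans (∑<-cong m (λ y → ∑tuples-distrib-+ a m k (h ∘ (_+_ (a + y))) (h′ ∘ (_+_ (a + y)))))
        (∑<-distrib-+ m (λ y → ∑tuples a m k (h ∘ (_+_ (a + y)))) (λ y → ∑tuples a m k (h′ ∘ (_+_ (a + y)))))

∑tuples-zero : ∀ a m k {h : ℕ → ℕ} → (∀ σ → h σ ≡ 0) → ∑tuples a m k h ≡ 0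
∑tuples-zero a m zero    h≗0 = h≗0 0
∑tuples-zero a m (suc k) h≗0 = ∑<-zero m (λ y → ∑tuples-zero a m k (λ σ → h≗0 (a + y + σ)))

∑tuples-shift : ∀ a m k h → ∑tuples (suc a) m k h ≡ ∑tuples a m k (λ σ → h (k + σ))
∑tuples-shift a m zero    h = refl
∑tuples-shift a m (suc k) h = ∑<-cong m λ y →
  trans (∑tuples-shift a m k (h ∘ (_+_ (suc a + y)))) (∑tuples-cong a m k (λ σ → cong h (reassoc a y k σ)))
  where
  reassoc : ∀ a y k σ → suc a + y + (k + σ) ≡ suc k + (a + y + σ)
  reassoc = solve-∀

-- Split the tuples according to the number x of entries equal to a.
∑tuples-split : ∀ a m k h → ∑tuples a (suc m) k h ≡
  ∑< (suc k) (λ x → (k C x) * ∑tuples (suc a) m (k ∸ x) (λ σ → h (a * x + σ)))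
∑tuples-split a m zero    h = sym (trans (+-identityʳ _) (trans (*-identityˡ _) (cong h a*0+0≡0)))
  where
  a*0+0≡0 : a * 0 + 0 ≡ 0
  a*0+0≡0 = trans (+-identityʳ (a * 0)) (*-zeroʳ a)
∑tuples-split a m (suc k) h = begin
  ∑tuples a (suc m) k (h ∘ (_+_ (a + 0))) + ∑< m (λ y → ∑tuples a (suc m) k (h ∘ (_+_ (a + suc y))))
    ≡⟨ cong₂ _+_ (∑tuples-split a m k (h ∘ (_+_ (a + 0))))
                 (∑<-cong m (λ y → ∑tuples-split a m k (h ∘ (_+_ (a + suc y))))) ⟩
  ∑< (suc k) (λ x → (k C x) * T (k ∸ x) (λ σ → h (a + 0 + (a * x + σ))))
    + ∑< m (λ y → ∑< (suc k) (λ x → (k C x) * T (k ∸ x) (λ σ → h (a + suc y + (a * x + σ)))))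
    ≡⟨ cong₂ _+_ (∑<-cong (suc k) firstIsA)
                 (trans (∑<-comm m (suc k) (λ y x → (k C x) * T (k ∸ x) (λ σ → h (a + suc y + (a * x + σ)))))
                        (∑<-cong-< (suc k) firstAboveA)) ⟩
  ∑< (suc k) (λ x → (k C x) * G (suc x)) + ∑< (suc k) (λ x → (k C x) * G x)
    ≡⟨ +-comm (∑< (suc k) (λ x → (k C x) * G (suc x))) _ ⟩
  ∑< (suc k) (λ x → (k C x) * G x) + ∑< (suc k) (λ x → (k C x) * G (suc x))
    ≡⟨ cong (_+ ∑< (suc k) (λ x → (k C x) * G (suc x))) (∑<-binomial-truncate G (n≤1+n k)) ⟨
  ∑< (suc (suc k)) (λ x → (k C x) * G x) + ∑< (suc k) (λ x → (k C x) * G (suc x))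
    ≡⟨ ∑<-pascal (suc k) k G ⟨
  ∑< (suc (suc k)) (λ x → (suc k C x) * G x)
    ∎
  where
  open ≡-Reasoning
  T : ℕ → (ℕ → ℕ) → ℕ
  T = ∑tuples (suc a) m
  G : ℕ → ℕ
  G x = T (suc k ∸ x) (λ σ → h (a * x + σ))
  firstIsA : ∀ x → (k C x) * T (k ∸ x) (λ σ → h (a + 0 + (a * x + σ))) ≡ (k C x) * G (suc x)
  firstIsA x = cong ((k C x) *_) (∑tuples-cong (suc a) m (k ∸ x) (λ σ → cong h (reassoc a x σ)))
    where
    reassoc : ∀ a x σ → a + 0 + (a * x + σ) ≡ a * suc x + σ
    reassoc = solve-∀
  firstAboveA : ∀ x → x < suc k →
    ∑< m (λ y → (k C x) * T (k ∸ x) (λ σ → h (a + suc y + (a * x + σ)))) ≡ (k C x) * G x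
  firstAboveA x x<1+k = begin
    ∑< m (λ y → (k C x) * T (k ∸ x) (λ σ → h (a + suc y + (a * x + σ))))
      ≡⟨ *-distribˡ-∑< m (k C x) (λ y → T (k ∸ x) (λ σ → h (a + suc y + (a * x + σ)))) ⟨
    (k C x) * ∑< m (λ y → T (k ∸ x) (λ σ → h (a + suc y + (a * x + σ))))
      ≡⟨ cong ((k C x) *_) (∑<-cong m (λ y → ∑tuples-cong (suc a) m (k ∸ x) (λ σ → cong h (reassoc a x y σ)))) ⟩
    (k C x) * T (suc (k ∸ x)) (λ σ → h (a * x + σ))
      ≡⟨ cong (λ j → (k C x) * T j (λ σ → h (a * x + σ))) (+-∸-assoc 1 (s≤s⁻¹ x<1+k)) ⟨
    (k C x) * G x
      ∎
    where
    reassoc : ∀ a x y σ → a + suc y + (a * x + σ) ≡ a * x + (suc a + y + σ)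
    reassoc = solve-∀

∑tuples-singleton : ∀ k g → ∑tuples 0 1 k g ≡ g 0
∑tuples-singleton zero    g = refl
∑tuples-singleton (suc k) g = trans (+-identityʳ _) (∑tuples-singleton k g)

-- Here x counts the nonzero entries, each of which is lowered by one.
∑tuples-by-nonzero : ∀ m k g → ∑tuples 0 (suc (suc m)) k g ≡
  ∑< (suc k) (λ x → (k C x) * ∑tuples 0 (suc m) x (λ σ → g (x + σ)))
∑tuples-by-nonzero m k g = begin
  ∑tuples 0 (suc (suc m)) k g
    ≡⟨ ∑tuples-split 0 (suc m) k g ⟩
  ∑< (suc k) (λ x → (k C x) * ∑tuples 1 (suc m) (k ∸ x) g)
    ≡⟨ ∑<-cong-< (suc k) (λ x x<1+k → cong₂ _*_ (nCk≡nC[n∸k] (s≤s⁻¹ x<1+k)) (∑tuples-shift 0 (suc m) (k ∸ x) g)) ⟩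
  ∑< (suc k) (λ x → (k C (k ∸ x)) * ∑tuples 0 (suc m) (k ∸ x) (λ σ → g (k ∸ x + σ)))
    ≡⟨ ∑<-reverse (suc k) (λ x → (k C x) * ∑tuples 0 (suc m) x (λ σ → g (x + σ))) ⟨
  ∑< (suc k) (λ x → (k C x) * ∑tuples 0 (suc m) x (λ σ → g (x + σ)))
    ∎
  where open ≡-Reasoning

sumVec-cong : ∀ m B {f g : Vec ℕ m → ℕ} → (∀ v → f v ≡ g v) → sumVec m B f ≡ sumVec m B g
sumVec-cong zero    B f≗g = f≗g []
sumVec-cong (suc m) B f≗g = cong sumList (map-cong (λ j → sumVec-cong m B (λ v → f≗g (j ∷ v))) (upTo (suc B)))

*-distribˡ-sumVec : ∀ m B c (f : Vec ℕ m → ℕ) → c * sumVec m B f ≡ sumVec m B (λ v → c * f v)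
*-distribˡ-sumVec zero    B c f = refl
*-distribˡ-sumVec (suc m) B c f = begin
  c * sumTo B (λ j → sumVec m B (λ v → f (j ∷ v)))
    ≡⟨ cong (c *_) (sumTo≡∑< B _) ⟩
  c * ∑< (suc B) (λ j → sumVec m B (λ v → f (j ∷ v)))
    ≡⟨ *-distribˡ-∑< (suc B) c (λ j → sumVec m B (λ v → f (j ∷ v))) ⟩
  ∑< (suc B) (λ j → c * sumVec m B (λ v → f (j ∷ v)))
    ≡⟨ ∑<-cong (suc B) (λ j → *-distribˡ-sumVec m B c (λ v → f (j ∷ v))) ⟩
  ∑< (suc B) (λ j → sumVec m B (λ v → c * f (j ∷ v)))
    ≡⟨ sumTo≡∑< B _ ⟨
  sumTo B (λ j → sumVec m B (λ v → c * f (j ∷ v)))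
    ∎
  where open ≡-Reasoning

-- In a tuple with entries in {0, …, t}, j_r is the number of entries that are at least r.
∑chainProd≡∑tuples : ∀ t B k g → k ≤ B →
  sumVec t B (λ j → chainProd k j * g (vsum j)) ≡ ∑tuples 0 (suc t) k g
∑chainProd≡∑tuples zero    B k g k≤B = trans (+-identityʳ (g 0)) (sym (∑tuples-singleton k g))
∑chainProd≡∑tuples (suc t) B k g k≤B = begin
  sumTo B (λ x → sumVec t B (λ j → ((k C x) * chainProd x j) * g (x + vsum j)))
    ≡⟨ sumTo≡∑< B _ ⟩
  ∑< (suc B) (λ x → sumVec t B (λ j → ((k C x) * chainProd x j) * g (x + vsum j)))
    ≡⟨ ∑<-cong (suc B) fixedFirst ⟩
  ∑< (suc B) (λ x → (k C x) * ∑tuples 0 (suc t) x (λ σ → g (x + σ)))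
    ≡⟨ ∑<-binomial-truncate (λ x → ∑tuples 0 (suc t) x (λ σ → g (x + σ))) k≤B ⟩
  ∑< (suc k) (λ x → (k C x) * ∑tuples 0 (suc t) x (λ σ → g (x + σ)))
    ≡⟨ ∑tuples-by-nonzero t k g ⟨
  ∑tuples 0 (suc (suc t)) k g
    ∎
  where
  open ≡-Reasoning
  fixedFirst : ∀ x → sumVec t B (λ j → ((k C x) * chainProd x j) * g (x + vsum j))
                   ≡ (k C x) * ∑tuples 0 (suc t) x (λ σ → g (x + σ))
  fixedFirst x = begin
    sumVec t B (λ j → ((k C x) * chainProd x j) * g (x + vsum j))
      ≡⟨ sumVec-cong t B (λ j → *-assoc (k C x) (chainProd x j) _) ⟩
    sumVec t B (λ j → (k C x) * (chainProd x j * g (x + vsum j)))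
      ≡⟨ *-distribˡ-sumVec t B (k C x) (λ j → chainProd x j * g (x + vsum j)) ⟨
    (k C x) * sumVec t B (λ j → chainProd x j * g (x + vsum j))
      ≡⟨ C*-congʳ k x (λ x≤k → ∑chainProd≡∑tuples t B x (λ σ → g (x + σ)) (≤-trans x≤k k≤B)) ⟩
    (k C x) * ∑tuples 0 (suc t) x (λ σ → g (x + σ))
      ∎

-- The empty product is 0 C k, which is 1 exactly when all of k has been distributed.
multinomial′ : ∀ {m} → ℕ → Vec ℕ m → ℕ
multinomial′ k []       = 0 C k
multinomial′ k (x ∷ xs) = (k C x) * multinomial′ (k ∸ x) xs

nCk*k![n∸k]!≡n! : ∀ {n k} → k ≤ n → (n C k) * (k ! * (n ∸ k) !) ≡ n !
nCk*k![n∸k]!≡n! {n} {k} k≤n = trans (cong (_* (k ! * (n ∸ k) !)) (nCk≡n!/k![n-k]! k≤n)) (m/n*n≡m (k![n∸k]!∣n! k≤n))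
  where instance _ = k !* (n ∸ k) !≢0

multinomial′-*-factProd : ∀ {m} (v : Vec ℕ m) → multinomial′ (vsum v) v * factProd v ≡ vsum v !
multinomial′-*-factProd []      = refl
multinomial′-*-factProd (x ∷ v) = begin
  (((x + r) C x) * multinomial′ (x + r ∸ x) v) * (x ! * factProd v)
    ≡⟨ cong (λ y → (((x + r) C x) * multinomial′ y v) * (x ! * factProd v)) (m+n∸m≡n x r) ⟩
  (((x + r) C x) * multinomial′ r v) * (x ! * factProd v)
    ≡⟨ regroup ((x + r) C x) (multinomial′ r v) (x !) (factProd v) ⟩
  ((x + r) C x) * (x ! * (multinomial′ r v * factProd v))
    ≡⟨ cong (λ y → ((x + r) C x) * (x ! * y)) (multinomial′-*-factProd v) ⟩
  ((x + r) C x) * (x ! * r !)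
    ≡⟨ cong (λ y → ((x + r) C x) * (x ! * y !)) (m+n∸m≡n x r) ⟨
  ((x + r) C x) * (x ! * (x + r ∸ x) !)
    ≡⟨ nCk*k![n∸k]!≡n! (m≤m+n x r) ⟩
  (x + r) !
    ∎
  where
  open ≡-Reasoning
  r : ℕ
  r = vsum v
  regroup : ∀ c m f g → (c * m) * (f * g) ≡ c * (f * (m * g))
  regroup = solve-∀

multinomial′-≢ : ∀ {m} k (v : Vec ℕ m) → vsum v ≢ k → multinomial′ k v ≡ 0
multinomial′-≢ zero    []      0≢0 = contradiction refl 0≢0
multinomial′-≢ (suc k) []      _   = refl
multinomial′-≢ k       (x ∷ v) ≢k  with x ≤? k
... | yes x≤k = trans (cong ((k C x) *_) (multinomial′-≢ (k ∸ x) v (≢k ∘ x+r≡k))) (*-zeroʳ (k C x))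
  where
  x+r≡k : vsum v ≡ k ∸ x → x + vsum v ≡ k
  x+r≡k r≡k∸x = trans (cong (_+_ x) r≡k∸x) (m+[n∸m]≡n x≤k)
... | no  x≰k = cong (_* multinomial′ (k ∸ x) v) (k>n⇒nCk≡0 (≰⇒> x≰k))

multinomial≡multinomial′ : ∀ {m} k (v : Vec ℕ m) → multinomial k v ≡ multinomial′ k v
multinomial≡multinomial′ k v with vsum v ≟ k
... | yes refl = trans (/-congˡ (sym (multinomial′-*-factProd v))) (m*n/n≡m (multinomial′ (vsum v) v) (factProd v))
  where instance _ = factProd≢0 v
... | no  ≢k   = sym (multinomial′-≢ k v ≢k)

-- v counts the entries of a tuple equal to a, a + 1, …, so weightedSumFrom a v is the sum of the tuple.
∑multinomial′≡∑tuples : ∀ m a k B → k ≤ B → ∀ h →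
  sumVec m B (λ v → multinomial′ k v * h (weightedSumFrom a v)) ≡ ∑tuples a m k h
∑multinomial′≡∑tuples zero    a zero    B _   h = +-identityʳ (h 0)
∑multinomial′≡∑tuples zero    a (suc k) B _   h = refl
∑multinomial′≡∑tuples (suc m) a k       B k≤B h = begin
  sumTo B (λ x → sumVec m B (λ v → ((k C x) * multinomial′ (k ∸ x) v) * h (a * x + weightedSumFrom (suc a) v)))
    ≡⟨ sumTo≡∑< B _ ⟩
  ∑< (suc B) (λ x → sumVec m B (λ v → ((k C x) * multinomial′ (k ∸ x) v) * h (a * x + weightedSumFrom (suc a) v)))
    ≡⟨ ∑<-cong (suc B) fixedFirst ⟩
  ∑< (suc B) (λ x → (k C x) * ∑tuples (suc a) m (k ∸ x) (λ σ → h (a * x + σ)))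
    ≡⟨ ∑<-binomial-truncate (λ x → ∑tuples (suc a) m (k ∸ x) (λ σ → h (a * x + σ))) k≤B ⟩
  ∑< (suc k) (λ x → (k C x) * ∑tuples (suc a) m (k ∸ x) (λ σ → h (a * x + σ)))
    ≡⟨ ∑tuples-split a m k h ⟨
  ∑tuples a (suc m) k h
    ∎
  where
  open ≡-Reasoning
  fixedFirst : ∀ x → sumVec m B (λ v → ((k C x) * multinomial′ (k ∸ x) v) * h (a * x + weightedSumFrom (suc a) v))
                   ≡ (k C x) * ∑tuples (suc a) m (k ∸ x) (λ σ → h (a * x + σ))
  fixedFirst x = begin
    sumVec m B (λ v → ((k C x) * multinomial′ (k ∸ x) v) * h (a * x + weightedSumFrom (suc a) v))
      ≡⟨ sumVec-cong m B (λ v → *-assoc (k C x) (multinomial′ (k ∸ x) v) _) ⟩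
    sumVec m B (λ v → (k C x) * (multinomial′ (k ∸ x) v * h (a * x + weightedSumFrom (suc a) v)))
      ≡⟨ *-distribˡ-sumVec m B (k C x) (λ v → multinomial′ (k ∸ x) v * h (a * x + weightedSumFrom (suc a) v)) ⟨
    (k C x) * sumVec m B (λ v → multinomial′ (k ∸ x) v * h (a * x + weightedSumFrom (suc a) v))
      ≡⟨ cong ((k C x) *_) (∑multinomial′≡∑tuples m (suc a) (k ∸ x) B (≤-trans (m∸n≤m k x) k≤B) (λ σ → h (a * x + σ))) ⟩
    (k C x) * ∑tuples (suc a) m (k ∸ x) (λ σ → h (a * x + σ))
      ∎

z-[a+b]≡z-a-b : ∀ z a b → z - + (a + b) ≡ z - + a - + b
z-[a+b]≡z-a-b z a b = trans (cong (λ w → z - w) (ℤ.pos-+ a b)) (sub-+ z (+ a) (+ b))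
  where
  sub-+ : ∀ z x y → z - (x ℤ.+ y) ≡ z - x - y
  sub-+ = ℤSolver.solve-∀

z-x-y≡z-y-x : ∀ z x y → z - x - y ≡ z - y - x
z-x-y≡z-y-x = ℤSolver.solve-∀

z-[1+j]<M : ∀ {z M} j → z ℤ.< + suc M → z - + suc j ℤ.< + M
z-[1+j]<M {z} {M} j z<1+M = ℤ.<-≤-trans (ℤ.+-monoˡ-< -[1+ j ] z<1+M)
  (ℤ.≤-trans (ℤ.≤-reflexive (ℤ.[1+m]⊖[1+n]≡m⊖n M j)) (ℤ.m⊖n≤m M j))

+[n+k]-+[k+σ]≡+n-+σ : ∀ n k σ → + (n + k) - + (k + σ) ≡ + n - + σ
+[n+k]-+[k+σ]≡+n-+σ n k σ = trans (cong₂ _-_ (ℤ.pos-+ n k) (ℤ.pos-+ k σ)) (cancel (+ n) (+ k) (+ σ))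
  where
  cancel : ∀ x y z → x ℤ.+ y - (y ℤ.+ z) ≡ x - z
  cancel = ℤSolver.solve-∀

binomℤ-pascal : ∀ w k → binomℤ w (suc k) ≡ binomℤ (w - + 1) (suc k) + binomℤ (w - + 1) k
binomℤ-pascal (+ zero)  k = refl
binomℤ-pascal (+ suc n) k = trans (sym (nCk+nC[k+1]≡[n+1]C[k+1] n k)) (+-comm (n C k) _)
binomℤ-pascal -[1+ n ]  k = refl

closedForm : (s : ℕ) → ℤ → ℕ → ℕ
closedForm s z k = ∑tuples 0 s k (λ σ → binomℤ (z - + σ) k)

closedForm-suc : ∀ s z k → closedForm s z (suc k) ≡
  closedForm s (z - + 1) (suc k) + ∑< s (λ i → closedForm s (z - + suc i) k)
closedForm-suc s z k = begin
  ∑tuples 0 s (suc k) (λ σ → binomℤ (z - + σ) (suc k))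
    ≡⟨ ∑tuples-cong 0 s (suc k) pascal ⟩
  ∑tuples 0 s (suc k) (λ σ → binomℤ (z - + 1 - + σ) (suc k) + binomℤ (z - + 1 - + σ) k)
    ≡⟨ ∑tuples-distrib-+ 0 s (suc k) (λ σ → binomℤ (z - + 1 - + σ) (suc k)) (λ σ → binomℤ (z - + 1 - + σ) k) ⟩
  closedForm s (z - + 1) (suc k) + ∑< s (λ y → ∑tuples 0 s k (λ σ → binomℤ (z - + 1 - + (y + σ)) k))
    ≡⟨ cong (_+_ (closedForm s (z - + 1) (suc k))) (∑<-cong s λ y → ∑tuples-cong 0 s k λ σ →
         cong (λ w → binomℤ w k) (trans (sym (z-[a+b]≡z-a-b z 1 (y + σ))) (z-[a+b]≡z-a-b z (suc y) σ))) ⟩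
  closedForm s (z - + 1) (suc k) + ∑< s (λ i → closedForm s (z - + suc i) k)
    ∎
  where
  open ≡-Reasoning
  pascal : ∀ σ → binomℤ (z - + σ) (suc k) ≡ binomℤ (z - + 1 - + σ) (suc k) + binomℤ (z - + 1 - + σ) k
  pascal σ = trans (binomℤ-pascal (z - + σ) k) (cong (λ w → binomℤ w (suc k) + binomℤ w k) (z-x-y≡z-y-x z (+ σ) (+ 1)))

closedForm-neg : ∀ s a k → closedForm s -[1+ a ] k ≡ 0
closedForm-neg s a k = ∑tuples-zero 0 s k λ { zero → refl ; (suc σ) → refl }

count : {A : Set} → (A → Bool) → List A → ℕ
count p []       = 0
count p (x ∷ xs) = if p x then suc (count p xs) else count p xs

length-filter≡count : {A : Set} (p : A → Bool) (xs : List A) → length (filter (λ x → p x Bool.≟ true) xs) ≡ count p xs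
length-filter≡count p []       = refl
length-filter≡count p (x ∷ xs) with p x
... | true  = cong suc (length-filter≡count p xs)
... | false = length-filter≡count p xs

count-cong : {A : Set} {p q : A → Bool} (xs : List A) → (∀ x → p x ≡ q x) → count p xs ≡ count q xs
count-cong []       p≗q = refl
count-cong {q = q} (x ∷ xs) p≗q rewrite p≗q x = cong (λ c → if q x then suc c else c) (count-cong xs p≗q)

count-++ : {A : Set} (p : A → Bool) (xs ys : List A) → count p (xs ++ ys) ≡ count p xs + count p ys
count-++ p []       ys = refl
count-++ p (x ∷ xs) ys with p x
... | true  = cong suc (count-++ p xs ys)
... | false = count-++ p xs ys

count-map : {A B : Set} (p : B → Bool) (f : A → B) (xs : List A) → count p (map f xs) ≡ count (p ∘ f) xs
count-map p f []       = refl
count-map p f (x ∷ xs) = cong (λ c → if p (f x) then suc c else c) (count-map p f xs)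

count-false : {A : Set} {p : A → Bool} (xs : List A) → (∀ x → p x ≡ false) → count p xs ≡ 0
count-false []       p≗false = refl
count-false (x ∷ xs) p≗false rewrite p≗false x = count-false xs p≗false

count-concatMap-tabulate : {A B : Set} (p : B → Bool) (g : A → List B) {n : ℕ} (f : Fin n → A) →
  count p (concatMap g (tabulate f)) ≡ sum {n} (λ i → count p (g (f i)))
count-concatMap-tabulate p g {zero}  f = refl
count-concatMap-tabulate p g {suc n} f =
  trans (count-++ p (g (f Fin.zero)) _) (cong (_+_ (count p (g (f Fin.zero)))) (count-concatMap-tabulate p g (f ∘ Fin.suc)))

endsAt? : (z : ℤ) (k : ℕ) (e : ℕ × ℕ) → Dec (+ proj₁ e ≡ z × proj₂ e ≡ k)
endsAt? z k (a , b) = (+ a ℤ.≟ z) ×-dec (b ≟ k)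

isEnd≡endsAt? : ∀ n k e → isEnd n k e ≡ does (endsAt? (+ n) k e)
isEnd≡endsAt? n k (a , b) with a ≟ n | b ≟ k
... | yes a≡n | yes b≡k = sym (dec-true (endsAt? (+ n) k (a , b)) (cong +_ a≡n , b≡k))
... | yes _   | no  b≢k = sym (dec-false (endsAt? (+ n) k (a , b)) (b≢k ∘ proj₂))
... | no  a≢n | _       = sym (dec-false (endsAt? (+ n) k (a , b)) (a≢n ∘ ℤ.+-injective ∘ proj₁))

+[j+a]≡z⇔+a≡z-j : ∀ j a z → (+ (j + a) ≡ z) ⇔ (+ a ≡ z - + j)
+[j+a]≡z⇔+a≡z-j j a z = mk⇔
  (λ e → trans (sym (x+y-x≡y (+ j) (+ a))) (cong (_- + j) (trans (sym (ℤ.pos-+ j a)) e)))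
  (λ e → trans (ℤ.pos-+ j a) (trans (cong (ℤ._+_ (+ j)) e) (x+[y-x]≡y (+ j) z)))
  where
  x+y-x≡y : ∀ x y → x ℤ.+ y - x ≡ y
  x+y-x≡y = ℤSolver.solve-∀
  x+[y-x]≡y : ∀ x y → x ℤ.+ (y - x) ≡ y
  x+[y-x]≡y = ℤSolver.solve-∀

endsAt?-step : ∀ z k j d a b → does (endsAt? z (d + k) (j + a , d + b)) ≡ does (endsAt? (z - + j) k (a , b))
endsAt?-step z k j d a b = does-⇔ (+[j+a]≡z⇔+a≡z-j j a z ×-⇔ mk⇔ (+-cancelˡ-≡ d b k) (cong (_+_ d)))
  (endsAt? z (d + k) (j + a , d + b)) (endsAt? (z - + j) k (a , b))

endsAt?-above : ∀ z j a b → does (endsAt? z 0 (j + a , suc b)) ≡ false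
endsAt?-above z j a b = dec-false (endsAt? z 0 (j + a , suc b)) (λ ())

-- Paths of m steps to (z, k); z ranges over ℤ so that the first-step recurrence needs no truncated subtraction.
pathsℤ : (s m : ℕ) → ℤ → ℕ → ℕ
pathsℤ s m z k = count (λ p → does (endsAt? z k (endpoint p))) (listsOfLength {s} m)

pathsℤ-suc : ∀ s m z k → pathsℤ s (suc m) z k ≡
  count (λ p → does (endsAt? z k (1 + proj₁ (endpoint p) , proj₂ (endpoint p)))) (listsOfLength {s} m)
  + ∑< s (λ i → count (λ p → does (endsAt? z k (suc i + proj₁ (endpoint p) , 1 + proj₂ (endpoint p)))) (listsOfLength {s} m))
pathsℤ-suc s m z k =
  trans (count-concatMap-tabulate reaches (λ x → map (x ∷_) paths) id)
        (cong₂ _+_ (count-map reaches (Fin.zero ∷_) paths)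
                   (sum-cong-≗ {s} (λ i → count-map reaches (Fin.suc i ∷_) paths)))
  where
  paths : List (List (Step s))
  paths = listsOfLength {s} m
  reaches : List (Step s) → Bool
  reaches p = does (endsAt? z k (endpoint p))

pathsℤ-suc-zero : ∀ s m z → pathsℤ s (suc m) z 0 ≡ pathsℤ s m (z - + 1) 0
pathsℤ-suc-zero s m z =
  trans (pathsℤ-suc s m z 0)
        (trans (cong₂ _+_ (count-cong paths (λ p → endsAt?-step z 0 1 0 (proj₁ (endpoint p)) (proj₂ (endpoint p))))
                          (∑<-zero s (λ i → count-false paths (λ p → endsAt?-above z (suc i) (proj₁ (endpoint p)) (proj₂ (endpoint p))))))
               (+-identityʳ _))
  where
  paths : List (List (Step s))
  paths = listsOfLength {s} m

pathsℤ-suc-suc : ∀ s m z k →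
  pathsℤ s (suc m) z (suc k) ≡ pathsℤ s m (z - + 1) (suc k) + ∑< s (λ i → pathsℤ s m (z - + suc i) k)
pathsℤ-suc-suc s m z k =
  trans (pathsℤ-suc s m z (suc k))
        (cong₂ _+_ (count-cong paths (λ p → endsAt?-step z (suc k) 1 0 (proj₁ (endpoint p)) (proj₂ (endpoint p))))
                   (∑<-cong s (λ i → count-cong paths (λ p → endsAt?-step z k (suc i) 1 (proj₁ (endpoint p)) (proj₂ (endpoint p))))))
  where
  paths : List (List (Step s))
  paths = listsOfLength {s} m

pathsℤ-zero-suc : ∀ s z k → pathsℤ s 0 z (suc k) ≡ 0
pathsℤ-zero-suc s z k = cong (λ b → if b then 1 else 0) (dec-false (endsAt? z (suc k) (0 , 0)) (λ ()))

-- [z = 0] + [z ≥ 1] = [z ≥ 0]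
pathsℤ-zero+closedForm : ∀ s z → pathsℤ s 0 z 0 + closedForm s (z - + 1) 0 ≡ closedForm s z 0
pathsℤ-zero+closedForm s (+ zero)  = refl
pathsℤ-zero+closedForm s (+ suc n) = refl
pathsℤ-zero+closedForm s -[1+ n ]  = refl

-- Every step moves right, so no path of M or more steps ends at an abscissa z < M.
∑pathsℤ≡closedForm : ∀ s M z k → z ℤ.< + M → ∑< M (λ m → pathsℤ s m z k) ≡ closedForm s z k
∑pathsℤ≡closedForm s zero    (+ n)    k (ℤ.+<+ ())
∑pathsℤ≡closedForm s zero    -[1+ a ] k _ = sym (closedForm-neg s a k)
∑pathsℤ≡closedForm s (suc M) z zero z<1+M = begin
  pathsℤ s 0 z 0 + ∑< M (λ m → pathsℤ s (suc m) z 0)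
    ≡⟨ cong (_+_ (pathsℤ s 0 z 0)) (∑<-cong M (λ m → pathsℤ-suc-zero s m z)) ⟩
  pathsℤ s 0 z 0 + ∑< M (λ m → pathsℤ s m (z - + 1) 0)
    ≡⟨ cong (_+_ (pathsℤ s 0 z 0)) (∑pathsℤ≡closedForm s M (z - + 1) 0 (z-[1+j]<M 0 z<1+M)) ⟩
  pathsℤ s 0 z 0 + closedForm s (z - + 1) 0
    ≡⟨ pathsℤ-zero+closedForm s z ⟩
  closedForm s z 0
    ∎
  where open ≡-Reasoning
∑pathsℤ≡closedForm s (suc M) z (suc k) z<1+M = begin
  pathsℤ s 0 z (suc k) + ∑< M (λ m → pathsℤ s (suc m) z (suc k))
    ≡⟨ cong₂ _+_ (pathsℤ-zero-suc s z k) (∑<-cong M (λ m → pathsℤ-suc-suc s m z k)) ⟩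
  ∑< M (λ m → pathsℤ s m (z - + 1) (suc k) + ∑< s (λ i → pathsℤ s m (z - + suc i) k))
    ≡⟨ ∑<-distrib-+ M (λ m → pathsℤ s m (z - + 1) (suc k)) (λ m → ∑< s (λ i → pathsℤ s m (z - + suc i) k)) ⟩
  ∑< M (λ m → pathsℤ s m (z - + 1) (suc k)) + ∑< M (λ m → ∑< s (λ i → pathsℤ s m (z - + suc i) k))
    ≡⟨ cong (_+_ (∑< M (λ m → pathsℤ s m (z - + 1) (suc k)))) (∑<-comm M s (λ m i → pathsℤ s m (z - + suc i) k)) ⟩
  ∑< M (λ m → pathsℤ s m (z - + 1) (suc k)) + ∑< s (λ i → ∑< M (λ m → pathsℤ s m (z - + suc i) k))
    ≡⟨ cong₂ _+_ (∑pathsℤ≡closedForm s M (z - + 1) (suc k) (z-[1+j]<M 0 z<1+M))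
                 (∑<-cong s (λ i → ∑pathsℤ≡closedForm s M (z - + suc i) k (z-[1+j]<M i z<1+M))) ⟩
  closedForm s (z - + 1) (suc k) + ∑< s (λ i → closedForm s (z - + suc i) k)
    ≡⟨ closedForm-suc s z k ⟨
  closedForm s z (suc k)
    ∎
  where open ≡-Reasoning

pathCount≡closedForm : ∀ s n k → pathCount s n k ≡ closedForm s (+ n) k
pathCount≡closedForm s n k = begin
  pathCount s n k
    ≡⟨ sumTo≡∑< n (pathsOfLength s n k) ⟩
  ∑< (suc n) (pathsOfLength s n k)
    ≡⟨ ∑<-cong (suc n) pathsOfLength≡pathsℤ ⟩
  ∑< (suc n) (λ m → pathsℤ s m (+ n) k)
    ≡⟨ ∑pathsℤ≡closedForm s (suc n) (+ n) k (ℤ.+<+ (n<1+n n)) ⟩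
  closedForm s (+ n) k
    ∎
  where
  open ≡-Reasoning
  pathsOfLength≡pathsℤ : ∀ m → pathsOfLength s n k m ≡ pathsℤ s m (+ n) k
  pathsOfLength≡pathsℤ m = trans (length-filter≡count (λ p → isEnd n k (endpoint p)) (listsOfLength m))
                                 (count-cong (listsOfLength m) (λ p → isEnd≡endsAt? n k (endpoint p)))

mainTheorem3 : (t n k : ℕ) →
    (pathCount (suc t) n k
      ≡ sumVec t k (λ j → chainProd k j * binomℤ (+ n - + vsum j) k))
    × (pathCount (suc t) n k
      ≡ sumVec (suc t) k (λ ks → multinomial k ks * binomℤ (+ (n + k) - + weightedSum ks) k))
mainTheorem3 t n k =
  (begin
    pathCount (suc t) n k
      ≡⟨ pathCount≡closedForm (suc t) n k ⟩
    ∑tuples 0 (suc t) k (λ σ → binomℤ (+ n - + σ) k)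
      ≡⟨ ∑chainProd≡∑tuples t k k (λ σ → binomℤ (+ n - + σ) k) ≤-refl ⟨
    sumVec t k (λ j → chainProd k j * binomℤ (+ n - + vsum j) k)
      ∎) ,
  (begin
    pathCount (suc t) n k
      ≡⟨ pathCount≡closedForm (suc t) n k ⟩
    ∑tuples 0 (suc t) k (λ σ → binomℤ (+ n - + σ) k)
      ≡⟨ ∑tuples-cong 0 (suc t) k (λ σ → cong (λ w → binomℤ w k) (+[n+k]-+[k+σ]≡+n-+σ n k σ)) ⟨
    ∑tuples 0 (suc t) k (λ σ → binomℤ (+ (n + k) - + (k + σ)) k)
      ≡⟨ ∑tuples-shift 0 (suc t) k (λ w → binomℤ (+ (n + k) - + w) k) ⟨
    ∑tuples 1 (suc t) k (λ w → binomℤ (+ (n + k) - + w) k)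
      ≡⟨ ∑multinomial′≡∑tuples (suc t) 1 k k ≤-refl (λ w → binomℤ (+ (n + k) - + w) k) ⟨
    sumVec (suc t) k (λ ks → multinomial′ k ks * binomℤ (+ (n + k) - + weightedSum ks) k)
      ≡⟨ sumVec-cong (suc t) k (λ ks → cong (_* binomℤ (+ (n + k) - + weightedSum ks) k) (multinomial≡multinomial′ k ks)) ⟨
    sumVec (suc t) k (λ ks → multinomial k ks * binomℤ (+ (n + k) - + weightedSum ks) k)
      ∎)
  where open ≡-Reasoning
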